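{- For every integer $k\ge0$, $T(2,2k;k)>T(2,2k;k+1)$.
   Context: For integers $n\ge0$ and $k\ge0$, $T(2,n;k)$ denotes the number of ways to select a set of $k$ squares from a $2\times n$ rectangular grid of unit squares ($2$ rows, $n$ columns) such that no two selected squares are horizontally or vertically adjacent (share an edge); $T(2,0;0)=1$, and $T(2,n;k)=0$ for $k>n$. -}

module Defs where

open import Data.Nat using (ℕ; zero; suc; _+_)
open import Data.Bool using (Bool; true; false; _∧_; _∨_; not; if_then_else_)
open import Data.Vec using (Vec; []; _∷_)
open import Data.List using (List; []; _∷_; map; _++_; length; filter; concatMap)
open import Data.Product using (_×_; _,_)
open import Relation.Binary.PropositionalEquality using (_≡_)
open import Data.Nat using (_≟_)
open import Relation.Nullary.Decidable using (⌊_⌋)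
open import Data.Bool.Properties using (T?)

-- A subset of the 2×n grid is a pair of rows (top, bottom), each a Vec Bool n;
-- entry true = square selected.  Column i of the grid is (top[i], bottom[i]).

allVecs : (n : ℕ) → List (Vec Bool n)
allVecs zero = [] ∷ []
allVecs (suc n) = concatMap (λ v → (false ∷ v) ∷ (true ∷ v) ∷ []) (allVecs n)

allGrids : (n : ℕ) → List (Vec Bool n × Vec Bool n)
allGrids n = concatMap (λ t → map (λ b → (t , b)) (allVecs n)) (allVecs n)

rowOK : {n : ℕ} → Vec Bool n → Bool
rowOK [] = true
rowOK (x ∷ []) = true
rowOK (x ∷ y ∷ v) = not (x ∧ y) ∧ rowOK (y ∷ v)

colOK : {n : ℕ} → Vec Bool n → Vec Bool n → Bool
colOK [] [] = true
colOK (x ∷ u) (y ∷ v) = not (x ∧ y) ∧ colOK u v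

independent : {n : ℕ} → Vec Bool n × Vec Bool n → Bool
independent (t , b) = rowOK t ∧ rowOK b ∧ colOK t b

count : {n : ℕ} → Vec Bool n → ℕ
count [] = 0
count (true ∷ v) = suc (count v)
count (false ∷ v) = count v

size : {n : ℕ} → Vec Bool n × Vec Bool n → ℕ
size (t , b) = count t + count b

T2 : ℕ → ℕ → ℕ
T2 n k = length (filter (λ g → T? (independent g ∧ ⌊ size g ≟ k ⌋)) (allGrids n))

module Submission where

-- T2 is rewritten as a double sum Σ2 over the two rows, and
-- independence as a column-by-column condition 'admissible x y' relative to a
-- preceding column (x , y).  Splitting off the first column then gives, for
-- E n k = T(2,n;k) and O n k (the same count after a preceding column holding
-- one square, summed over its two positions), the transfer recurrences
--     E (n+1) (k+1) = E n (k+1) + O n k,    O (n+1) (k+1) = 2 E n (k+1) + O n k,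
-- together with E n 0 = 1, O n 0 = 2 and E n k = 0 for k > n.
--
-- The numbers τ obeying the Delannoy-type recurrence
-- τ(m+1,k+1) = τ(m+1,k) + τ(m,k+1) + τ(m,k) satisfy
-- τ(m+1,k) + τ(m,k) = 2·D(m,k) with D the (symmetric) Delannoy numbers, whence
-- the duality  k · τ(m,k) = m · τ(k,m).  Comparing recurrences shows
-- T(2,m+k;k) = τ(m+1,k), and for m = k+1 the duality reads
-- k · T(2,2k;k) = (k+1) · T(2,2k;k+1), which gives the claim.

open import Data.Nat using (ℕ; zero; suc; _+_; _*_; _≤_; _<_; _>_; _≡ᵇ_; z≤n; s≤s)
open import Data.Nat.Properties
  using (_≟_; +-suc; +-comm; +-identityʳ; ≤-refl; *-zeroʳ; ≡ᵇ⇒≡; m≤n⇒m≤1+n; ≤-trans; ≤-<-trans;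
         m≤m+n; m<n+m; *-monoʳ-≤; ≰⇒>; <-irrefl; <-≤-trans; +-commutativeSemigroup)
open import Algebra.Properties.CommutativeSemigroup +-commutativeSemigroup
  using () renaming (interchange to +-interchange)
open import Data.Nat.ListAction using (sum)
open import Data.Nat.ListAction.Properties using (sum-++)
open import Data.Nat.Tactic.RingSolver using (solve-∀)
open import Data.Bool using (Bool; true; false; T; not; _∧_)
open import Data.Bool.Properties using (T?; ∧-zeroʳ)
open import Data.Vec using (Vec; []; _∷_)
open import Data.List using (List; []; _∷_; _++_; map; concatMap; filter; length)
open import Data.List.Properties using (map-++; map-cong; map-∘)
open import Data.Product using (_×_; _,_; proj₁; proj₂)
open import Data.Empty using (⊥; ⊥-elim)
open import Relation.Nullary.Decidable using (⌊_⌋; isYes≗does)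
open import Relation.Binary.PropositionalEquality
  using (_≡_; refl; sym; trans; cong; cong₂; subst; subst₂; module ≡-Reasoning)

open import Defs

open ≡-Reasoning

ΣBool : (n : ℕ) → (Vec Bool n → ℕ) → ℕ
ΣBool zero    f = f []
ΣBool (suc n) f = ΣBool n (λ v → f (false ∷ v) + f (true ∷ v))

ΣBool-cong : ∀ n {f g : Vec Bool n → ℕ} → (∀ v → f v ≡ g v) → ΣBool n f ≡ ΣBool n g
ΣBool-cong zero    f≗g = f≗g []
ΣBool-cong (suc n) f≗g = ΣBool-cong n (λ v → cong₂ _+_ (f≗g (false ∷ v)) (f≗g (true ∷ v)))

ΣBool-+ : ∀ n (f g : Vec Bool n → ℕ) → ΣBool n (λ v → f v + g v) ≡ ΣBool n f + ΣBool n g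
ΣBool-+ zero    f g = refl
ΣBool-+ (suc n) f g =
  trans (ΣBool-cong n (λ v → +-interchange (f (false ∷ v)) (g (false ∷ v)) (f (true ∷ v)) (g (true ∷ v))))
        (ΣBool-+ n (λ v → f (false ∷ v) + f (true ∷ v)) (λ v → g (false ∷ v) + g (true ∷ v)))

ΣBool-zero : ∀ n → ΣBool n (λ _ → 0) ≡ 0
ΣBool-zero zero    = refl
ΣBool-zero (suc n) = ΣBool-zero n

Σ2 : (n : ℕ) → (Vec Bool n → Vec Bool n → ℕ) → ℕ
Σ2 n f = ΣBool n (λ t → ΣBool n (λ b → f t b))

Σ2-cong : ∀ n {f g : Vec Bool n → Vec Bool n → ℕ} → (∀ t b → f t b ≡ g t b) → Σ2 n f ≡ Σ2 n g
Σ2-cong n f≗g = ΣBool-cong n (λ t → ΣBool-cong n (f≗g t))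

Σ2-zero : ∀ n → Σ2 n (λ _ _ → 0) ≡ 0
Σ2-zero n = trans (ΣBool-cong n (λ _ → ΣBool-zero n)) (ΣBool-zero n)

Σ2-cons : ∀ n (f : Vec Bool (suc n) → Vec Bool (suc n) → ℕ) → Σ2 (suc n) f ≡
  (Σ2 n (λ t b → f (false ∷ t) (false ∷ b)) + Σ2 n (λ t b → f (false ∷ t) (true ∷ b)))
  + (Σ2 n (λ t b → f (true ∷ t) (false ∷ b)) + Σ2 n (λ t b → f (true ∷ t) (true ∷ b)))
Σ2-cons n f =
  begin
    ΣBool n (λ t → ΣBool n (λ b → column false false t b + column false true t b)
                 + ΣBool n (λ b → column true false t b + column true true t b))
  ≡⟨ ΣBool-cong n (λ t → cong₂ _+_ (ΣBool-+ n (column false false t) (column false true t))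
                                    (ΣBool-+ n (column true false t) (column true true t))) ⟩
    ΣBool n (λ t → (Σc false false t + Σc false true t) + (Σc true false t + Σc true true t))
  ≡⟨ ΣBool-+ n (λ t → Σc false false t + Σc false true t) (λ t → Σc true false t + Σc true true t) ⟩
    ΣBool n (λ t → Σc false false t + Σc false true t) + ΣBool n (λ t → Σc true false t + Σc true true t)
  ≡⟨ cong₂ _+_ (ΣBool-+ n (Σc false false) (Σc false true)) (ΣBool-+ n (Σc true false) (Σc true true)) ⟩
    (ΣBool n (Σc false false) + ΣBool n (Σc false true)) + (ΣBool n (Σc true false) + ΣBool n (Σc true true))
  ∎
  where
  column : Bool → Bool → Vec Bool n → Vec Bool n → ℕ
  column x y t b = f (x ∷ t) (y ∷ b)
  Σc : Bool → Bool → Vec Bool n → ℕ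
  Σc x y t = ΣBool n (column x y t)

𝟙 : Bool → ℕ
𝟙 true  = 1
𝟙 false = 0

𝟙-∧-≡0 : ∀ p q → (T p → T q → ⊥) → 𝟙 (p ∧ q) ≡ 0
𝟙-∧-≡0 false q     _ = refl
𝟙-∧-≡0 true  false _ = refl
𝟙-∧-≡0 true  true  h = ⊥-elim (h _ _)

length-filter : ∀ {A : Set} (p : A → Bool) (xs : List A) →
                length (filter (λ x → T? (p x)) xs) ≡ sum (map (λ x → 𝟙 (p x)) xs)
length-filter p []       = refl
length-filter p (x ∷ xs) with p x
... | true  = cong suc (length-filter p xs)
... | false = length-filter p xs

sum-concatMap : ∀ {A B : Set} (f : B → ℕ) (g : A → List B) (xs : List A) →
                sum (map f (concatMap g xs)) ≡ sum (map (λ x → sum (map f (g x))) xs)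
sum-concatMap f g []       = refl
sum-concatMap f g (x ∷ xs) =
  begin
    sum (map f (g x ++ concatMap g xs))
  ≡⟨ cong sum (map-++ f (g x) (concatMap g xs)) ⟩
    sum (map f (g x) ++ map f (concatMap g xs))
  ≡⟨ sum-++ (map f (g x)) (map f (concatMap g xs)) ⟩
    sum (map f (g x)) + sum (map f (concatMap g xs))
  ≡⟨ cong (sum (map f (g x)) +_) (sum-concatMap f g xs) ⟩
    sum (map f (g x)) + sum (map (λ x → sum (map f (g x))) xs)
  ∎

sum-allVecs : ∀ n (f : Vec Bool n → ℕ) → sum (map f (allVecs n)) ≡ ΣBool n f
sum-allVecs zero    f = +-identityʳ (f [])
sum-allVecs (suc n) f =
  begin
    sum (map f (concatMap (λ v → (false ∷ v) ∷ (true ∷ v) ∷ []) (allVecs n)))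
  ≡⟨ sum-concatMap f (λ v → (false ∷ v) ∷ (true ∷ v) ∷ []) (allVecs n) ⟩
    sum (map (λ v → f (false ∷ v) + (f (true ∷ v) + 0)) (allVecs n))
  ≡⟨ cong sum (map-cong (λ v → cong (f (false ∷ v) +_) (+-identityʳ (f (true ∷ v)))) (allVecs n)) ⟩
    sum (map (λ v → f (false ∷ v) + f (true ∷ v)) (allVecs n))
  ≡⟨ sum-allVecs n (λ v → f (false ∷ v) + f (true ∷ v)) ⟩
    ΣBool (suc n) f
  ∎

sum-allGrids : ∀ n (f : Vec Bool n × Vec Bool n → ℕ) → sum (map f (allGrids n)) ≡ Σ2 n (λ t b → f (t , b))
sum-allGrids n f =
  begin
    sum (map f (allGrids n))
  ≡⟨ sum-concatMap f (λ t → map (t ,_) (allVecs n)) (allVecs n) ⟩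
    sum (map (λ t → sum (map f (map (t ,_) (allVecs n)))) (allVecs n))
  ≡⟨ cong sum (map-cong row (allVecs n)) ⟩
    sum (map (λ t → ΣBool n (λ b → f (t , b))) (allVecs n))
  ≡⟨ sum-allVecs n (λ t → ΣBool n (λ b → f (t , b))) ⟩
    Σ2 n (λ t b → f (t , b))
  ∎
  where
  row : ∀ t → sum (map f (map (t ,_) (allVecs n))) ≡ ΣBool n (λ b → f (t , b))
  row t = trans (cong sum (sym (map-∘ (allVecs n)))) (sum-allVecs n (λ b → f (t , b)))

-- This column-by-column form makes grid extension definitional.
admissible : {n : ℕ} → Bool → Bool → Vec Bool n → Vec Bool n → Bool
admissible x y []        []        = true
admissible x y (t₀ ∷ t) (b₀ ∷ b) = not (x ∧ t₀) ∧ not (y ∧ b₀) ∧ not (t₀ ∧ b₀) ∧ admissible t₀ b₀ t b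

∧-shuffle : ∀ p q r P Q R → (p ∧ P) ∧ (q ∧ Q) ∧ (r ∧ R) ≡ p ∧ q ∧ r ∧ (P ∧ Q ∧ R)
∧-shuffle false q     r     P Q R = refl
∧-shuffle true  false r     P Q R = ∧-zeroʳ P
∧-shuffle true  true  false P Q R = trans (cong (P ∧_) (∧-zeroʳ Q)) (∧-zeroʳ P)
∧-shuffle true  true  true  P Q R = refl

rows-admissible : ∀ {n} x y (t b : Vec Bool n) → rowOK (x ∷ t) ∧ rowOK (y ∷ b) ∧ colOK t b ≡ admissible x y t b
rows-admissible x y []        []        = refl
rows-admissible x y (t₀ ∷ t) (b₀ ∷ b) =
  trans (∧-shuffle (not (x ∧ t₀)) (not (y ∧ b₀)) (not (t₀ ∧ b₀)) (rowOK (t₀ ∷ t)) (rowOK (b₀ ∷ b)) (colOK t b))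
        (cong (λ A → not (x ∧ t₀) ∧ not (y ∧ b₀) ∧ not (t₀ ∧ b₀) ∧ A) (rows-admissible t₀ b₀ t b))

rowOK-after-empty : ∀ {n} (v : Vec Bool n) → rowOK (false ∷ v) ≡ rowOK v
rowOK-after-empty []      = refl
rowOK-after-empty (_ ∷ _) = refl

independent-admissible : ∀ {n} (t b : Vec Bool n) → independent (t , b) ≡ admissible false false t b
independent-admissible t b =
  trans (cong₂ (λ p q → p ∧ q ∧ colOK t b) (sym (rowOK-after-empty t)) (sym (rowOK-after-empty b)))
        (rows-admissible false false t b)

cells : {n : ℕ} → Vec Bool n → Vec Bool n → ℕ
cells []        []        = 0
cells (t₀ ∷ t) (b₀ ∷ b) = 𝟙 t₀ + 𝟙 b₀ + cells t b

count-cons : ∀ {n} x (v : Vec Bool n) → count (x ∷ v) ≡ 𝟙 x + count v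
count-cons true  v = refl
count-cons false v = refl

size-cells : ∀ {n} (t b : Vec Bool n) → size (t , b) ≡ cells t b
size-cells []        []        = refl
size-cells (t₀ ∷ t) (b₀ ∷ b) =
  begin
    count (t₀ ∷ t) + count (b₀ ∷ b)
  ≡⟨ cong₂ _+_ (count-cons t₀ t) (count-cons b₀ b) ⟩
    (𝟙 t₀ + count t) + (𝟙 b₀ + count b)
  ≡⟨ +-interchange (𝟙 t₀) (count t) (𝟙 b₀) (count b) ⟩
    (𝟙 t₀ + 𝟙 b₀) + (count t + count b)
  ≡⟨ cong (𝟙 t₀ + 𝟙 b₀ +_) (size-cells t b) ⟩
    cells (t₀ ∷ t) (b₀ ∷ b)
  ∎

T-∧-right : ∀ p {q} → T (p ∧ q) → T q
T-∧-right true  h = h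
T-∧-right false ()

-- Admissible grids have at most one selected square per column.
admissible-cells≤ : ∀ {n} x y (t b : Vec Bool n) → T (admissible x y t b) → cells t b ≤ n
admissible-cells≤ x y [] [] _ = z≤n
admissible-cells≤ {suc n} x y (t₀ ∷ t) (b₀ ∷ b) adm =
  column t₀ b₀ (T-∧-right (not (y ∧ b₀)) (T-∧-right (not (x ∧ t₀)) adm))
  where
  column : ∀ t₀ b₀ → T (not (t₀ ∧ b₀) ∧ admissible t₀ b₀ t b) → 𝟙 t₀ + 𝟙 b₀ + cells t b ≤ suc n
  column false false h = m≤n⇒m≤1+n (admissible-cells≤ false false t b h)
  column true  false h = s≤s (admissible-cells≤ true false t b h)
  column false true  h = s≤s (admissible-cells≤ false true t b h)
  column true  true  ()

weight : {n : ℕ} → Bool → Bool → Vec Bool n → Vec Bool n → ℕ → ℕ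
weight x y t b k = 𝟙 (admissible x y t b ∧ (cells t b ≡ᵇ k))

N : Bool → Bool → ℕ → ℕ → ℕ
N x y n k = Σ2 n (λ t b → weight x y t b k)

E O : ℕ → ℕ → ℕ
E n k = N false false n k
O n k = N true false n k + N false true n k

T2≡E : ∀ n k → T2 n k ≡ E n k
T2≡E n k =
  begin
    T2 n k
  ≡⟨ length-filter (λ g → independent g ∧ ⌊ size g ≟ k ⌋) (allGrids n) ⟩
    sum (map (λ g → 𝟙 (independent g ∧ ⌊ size g ≟ k ⌋)) (allGrids n))
  ≡⟨ sum-allGrids n (λ g → 𝟙 (independent g ∧ ⌊ size g ≟ k ⌋)) ⟩
    Σ2 n (λ t b → 𝟙 (independent (t , b) ∧ ⌊ size (t , b) ≟ k ⌋))
  ≡⟨ Σ2-cong n (λ t b → cong₂ (λ p q → 𝟙 (p ∧ q)) (independent-admissible t b) (size-test t b)) ⟩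
    E n k
  ∎
  where
  size-test : ∀ t b → ⌊ size (t , b) ≟ k ⌋ ≡ (cells t b ≡ᵇ k)
  size-test t b = trans (isYes≗does (size (t , b) ≟ k)) (cong (_≡ᵇ k) (size-cells t b))

empty-column : ∀ x y {n} (t b : Vec Bool n) k → weight x y (false ∷ t) (false ∷ b) k ≡ weight false false t b k
empty-column false false t b k = refl
empty-column false true  t b k = refl
empty-column true  false t b k = refl
empty-column true  true  t b k = refl

-- Only the empty grid has no squares.
N-zero : ∀ x y n → N x y n 0 ≡ 1
N-zero x y zero    = refl
N-zero x y (suc n) =
  begin
    N x y (suc n) 0
  ≡⟨ Σ2-cons n (λ t b → weight x y t b 0) ⟩
    (Σ2 n (λ t b → weight x y (false ∷ t) (false ∷ b) 0) + occupied false true)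
    + (occupied true false + occupied true true)
  ≡⟨ cong₂ _+_ (cong₂ _+_ (trans (Σ2-cong n (λ t b → empty-column x y t b 0)) (N-zero false false n))
                           (no-squares false true (λ _ _ ())))
               (cong₂ _+_ (no-squares true false (λ _ _ ())) (no-squares true true (λ _ _ ()))) ⟩
    1
  ∎
  where
  occupied : Bool → Bool → ℕ
  occupied t₀ b₀ = Σ2 n (λ t b → weight x y (t₀ ∷ t) (b₀ ∷ b) 0)
  no-squares : ∀ t₀ b₀ → (∀ (t b : Vec Bool n) → T (cells (t₀ ∷ t) (b₀ ∷ b) ≡ᵇ 0) → ⊥) →
               occupied t₀ b₀ ≡ 0
  no-squares t₀ b₀ nonempty =
    trans (Σ2-cong n (λ t b → 𝟙-∧-≡0 (admissible x y (t₀ ∷ t) (b₀ ∷ b)) _ (λ _ → nonempty t b)))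
          (Σ2-zero n)

O-zero : ∀ n → O n 0 ≡ 2
O-zero n = cong₂ _+_ (N-zero true false n) (N-zero false true n)

N-oversized : ∀ x y n k → n < k → N x y n k ≡ 0
N-oversized x y n k n<k = trans (Σ2-cong n too-big) (Σ2-zero n)
  where
  too-big : ∀ t b → weight x y t b k ≡ 0
  too-big t b = 𝟙-∧-≡0 (admissible x y t b) (cells t b ≡ᵇ k)
    (λ adm eq → <-irrefl (≡ᵇ⇒≡ (cells t b) k eq) (≤-<-trans (admissible-cells≤ x y t b adm) n<k))

-- The transfer recurrences: the first column is empty, holds a square in a row
-- not used by the preceding column, or holds two squares; forbidden columns
-- contribute Σ2 n (λ _ _ → 0) by computation of 'admissible'.
E-suc : ∀ n k → E (suc n) (suc k) ≡ E n (suc k) + O n k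
E-suc n k =
  begin
    E (suc n) (suc k)
  ≡⟨ Σ2-cons n (λ t b → weight false false t b (suc k)) ⟩
    (E n (suc k) + N false true n k) + (N true false n k + Σ2 n (λ _ _ → 0))
  ≡⟨ cong (λ z → (E n (suc k) + N false true n k) + (N true false n k + z)) (Σ2-zero n) ⟩
    (E n (suc k) + N false true n k) + (N true false n k + 0)
  ≡⟨ rearrange (E n (suc k)) (N false true n k) (N true false n k) ⟩
    E n (suc k) + O n k
  ∎
  where
  rearrange : ∀ a b c → (a + b) + (c + 0) ≡ a + (c + b)
  rearrange = solve-∀

O-suc : ∀ n k → O (suc n) (suc k) ≡ E n (suc k) + E n (suc k) + O n k
O-suc n k =
  begin
    O (suc n) (suc k)
  ≡⟨ cong₂ _+_ (Σ2-cons n (λ t b → weight true false t b (suc k)))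
               (Σ2-cons n (λ t b → weight false true t b (suc k))) ⟩
    ((E n (suc k) + N false true n k) + (Z + Z)) + ((E n (suc k) + Z) + (N true false n k + Z))
  ≡⟨ cong (λ z → ((E n (suc k) + N false true n k) + (z + z)) + ((E n (suc k) + z) + (N true false n k + z)))
          (Σ2-zero n) ⟩
    ((E n (suc k) + N false true n k) + 0) + ((E n (suc k) + 0) + (N true false n k + 0))
  ≡⟨ rearrange (E n (suc k)) (N false true n k) (N true false n k) ⟩
    E n (suc k) + E n (suc k) + O n k
  ∎
  where
  Z : ℕ
  Z = Σ2 n (λ _ _ → 0)
  rearrange : ∀ a b c → ((a + b) + 0) + ((a + 0) + (c + 0)) ≡ a + a + (c + b)
  rearrange = solve-∀

-- τ (m+1) k = T(2, m+k; k); the boundary τ 0 k = [k = 0] makes the Delannoy-type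
-- recurrence hold everywhere.
τ : ℕ → ℕ → ℕ
τ zero    zero    = 1
τ zero    (suc k) = 0
τ (suc m) zero    = 1
τ (suc m) (suc k) = τ (suc m) k + τ m (suc k) + τ m k

delannoy : ℕ → ℕ → ℕ
delannoy zero    k       = 1
delannoy (suc m) zero    = 1
delannoy (suc m) (suc k) = delannoy m (suc k) + delannoy (suc m) k + delannoy m k

delannoy-sym : ∀ m k → delannoy m k ≡ delannoy k m
delannoy-sym zero    zero    = refl
delannoy-sym zero    (suc k) = refl
delannoy-sym (suc m) zero    = refl
delannoy-sym (suc m) (suc k) =
  begin
    delannoy m (suc k) + delannoy (suc m) k + delannoy m k
  ≡⟨ cong₂ _+_ (cong₂ _+_ (delannoy-sym m (suc k)) (delannoy-sym (suc m) k)) (delannoy-sym m k) ⟩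
    delannoy (suc k) m + delannoy k (suc m) + delannoy k m
  ≡⟨ cong (_+ delannoy k m) (+-comm (delannoy (suc k) m) (delannoy k (suc m))) ⟩
    delannoy k (suc m) + delannoy (suc k) m + delannoy k m
  ∎

-- Adjacent τ numbers add up to twice a Delannoy number (both sides obey the
-- same recurrence).
τ-delannoy : ∀ m k → τ (suc m) k + τ m k ≡ 2 * delannoy m k
τ-delannoy zero    zero    = refl
τ-delannoy zero    (suc k) = trans (drop-zeros (τ 1 k) (τ 0 k)) (τ-delannoy zero k)
  where
  drop-zeros : ∀ a b → (a + 0 + b) + 0 ≡ a + b
  drop-zeros = solve-∀
τ-delannoy (suc m) zero    = refl
τ-delannoy (suc m) (suc k) =
  begin
    (τ (suc (suc m)) k + τ (suc m) (suc k) + τ (suc m) k) + (τ (suc m) k + τ m (suc k) + τ m k)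
  ≡⟨ regroup (τ (suc (suc m)) k) (τ (suc m) (suc k)) (τ (suc m) k) (τ m (suc k)) (τ m k) ⟩
    (τ (suc m) (suc k) + τ m (suc k)) + (τ (suc (suc m)) k + τ (suc m) k) + (τ (suc m) k + τ m k)
  ≡⟨ cong₂ _+_ (cong₂ _+_ (τ-delannoy m (suc k)) (τ-delannoy (suc m) k)) (τ-delannoy m k) ⟩
    2 * delannoy m (suc k) + 2 * delannoy (suc m) k + 2 * delannoy m k
  ≡⟨ factor (delannoy m (suc k)) (delannoy (suc m) k) (delannoy m k) ⟩
    2 * delannoy (suc m) (suc k)
  ∎
  where
  regroup : ∀ a b c d e → (a + b + c) + (c + d + e) ≡ (b + d) + (a + c) + (c + e)
  regroup = solve-∀
  factor : ∀ a b c → 2 * a + 2 * b + 2 * c ≡ 2 * (a + b + c)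
  factor = solve-∀

τ-pair-sym : ∀ m k → τ (suc m) k + τ m k ≡ τ (suc k) m + τ k m
τ-pair-sym m k =
  begin
    τ (suc m) k + τ m k  ≡⟨ τ-delannoy m k ⟩
    2 * delannoy m k     ≡⟨ cong (2 *_) (delannoy-sym m k) ⟩
    2 * delannoy k m     ≡⟨ τ-delannoy k m ⟨
    τ (suc k) m + τ k m  ∎

τ-duality : ∀ m k → k * τ m k ≡ m * τ k m
τ-duality zero    zero    = refl
τ-duality zero    (suc k) = *-zeroʳ (suc k)
τ-duality (suc m) zero    = sym (*-zeroʳ (suc m))
τ-duality (suc m) (suc k) =
  begin
    suc k * (x₁ + x₂ + x₃)
  ≡⟨ expand k x₁ x₂ x₃ ⟩
    (x₁ + x₃) + k * x₁ + suc k * x₂ + k * x₃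
  ≡⟨ cong₂ _+_ (cong₂ _+_ (cong₂ _+_ (τ-pair-sym m k) (τ-duality (suc m) k)) (τ-duality m (suc k)))
               (τ-duality m k) ⟩
    (y₁ + y₃) + suc m * y₂ + m * y₁ + m * y₃
  ≡⟨ collect m y₁ y₂ y₃ ⟩
    suc m * (y₁ + y₂ + y₃)
  ∎
  where
  x₁ x₂ x₃ y₁ y₂ y₃ : ℕ
  x₁ = τ (suc m) k
  x₂ = τ m (suc k)
  x₃ = τ m k
  y₁ = τ (suc k) m
  y₂ = τ k (suc m)
  y₃ = τ k m
  expand : ∀ j a b c → suc j * (a + b + c) ≡ (a + c) + j * a + suc j * b + j * c
  expand = solve-∀
  collect : ∀ i a b c → (a + c) + suc i * b + i * a + i * c ≡ suc i * (a + b + c)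
  collect = solve-∀

τ-positive : ∀ m k → 0 < τ (suc m) k
τ-positive m zero    = s≤s z≤n
τ-positive m (suc k) =
  ≤-trans (τ-positive m k)
          (≤-trans (m≤m+n (τ (suc m) k) (τ m (suc k))) (m≤m+n (τ (suc m) k + τ m (suc k)) (τ m k)))

Diagonal : ℕ → ℕ → Set
Diagonal m k = E (m + k) k ≡ τ (suc m) k × O (m + k) k ≡ τ (suc m) k + τ m k

-- On the diagonal m = 0 (k squares in width k) the step uses that a grid of
-- width k has no room for k+1 squares.
diagonal-step₀ : ∀ k → O k k ≡ τ 1 k + τ 0 k → Diagonal zero (suc k)
diagonal-step₀ k O≡ = E-step , O-step
  where
  no-overflow : E k (suc k) ≡ 0
  no-overflow = N-oversized false false k (suc k) (s≤s ≤-refl)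
  pad : ∀ a b → a + b ≡ a + 0 + b
  pad = solve-∀
  E-step : E (suc k) (suc k) ≡ τ 1 k + 0 + τ 0 k
  E-step = trans (E-suc k k) (trans (cong₂ _+_ no-overflow O≡) (pad (τ 1 k) (τ 0 k)))
  O-step : O (suc k) (suc k) ≡ (τ 1 k + 0 + τ 0 k) + 0
  O-step = trans (O-suc k k) (trans (cong₂ _+_ (cong₂ _+_ no-overflow no-overflow) O≡)
                                     (trans (pad (τ 1 k) (τ 0 k)) (sym (+-identityʳ (τ 1 k + 0 + τ 0 k)))))

-- Away from the boundary, the transfer recurrences reproduce the τ recurrence.
diagonal-step : ∀ m k → E (m + suc k) (suc k) ≡ τ (suc m) (suc k) → O (suc m + k) k ≡ τ (suc (suc m)) k + τ (suc m) k →
                Diagonal (suc m) (suc k)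
diagonal-step m k E≡ O≡′ = E-step , O-step
  where
  O≡ : O (m + suc k) k ≡ τ (suc (suc m)) k + τ (suc m) k
  O≡ = subst (λ n → O n k ≡ τ (suc (suc m)) k + τ (suc m) k) (sym (+-suc m k)) O≡′
  E-order : ∀ a b c → a + (b + c) ≡ b + a + c
  E-order = solve-∀
  O-order : ∀ a b c → a + a + (b + c) ≡ (b + a + c) + a
  O-order = solve-∀
  E-step : E (suc m + suc k) (suc k) ≡ τ (suc (suc m)) (suc k)
  E-step = trans (E-suc (m + suc k) k) (trans (cong₂ _+_ E≡ O≡)
                 (E-order (τ (suc m) (suc k)) (τ (suc (suc m)) k) (τ (suc m) k)))
  O-step : O (suc m + suc k) (suc k) ≡ τ (suc (suc m)) (suc k) + τ (suc m) (suc k)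
  O-step = trans (O-suc (m + suc k) k) (trans (cong₂ _+_ (cong₂ _+_ E≡ E≡) O≡)
                 (O-order (τ (suc m) (suc k)) (τ (suc (suc m)) k) (τ (suc m) k)))

diagonal : ∀ m k → Diagonal m k
diagonal zero    zero    = refl , refl
diagonal (suc m) zero    = N-zero false false (suc m + 0) , O-zero (suc m + 0)
diagonal zero    (suc k) = diagonal-step₀ k (proj₂ (diagonal zero k))
diagonal (suc m) (suc k) = diagonal-step m k (proj₁ (diagonal m (suc k))) (proj₂ (diagonal (suc m) k))

T2-diagonal : ∀ m k → T2 (m + k) k ≡ τ (suc m) k
T2-diagonal m k = trans (T2≡E (m + k) k) (proj₁ (diagonal m k))

smaller-by-ratio : ∀ k X Y → k * X ≡ suc k * Y → 0 < X → Y < X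
smaller-by-ratio k X Y eq X>0 = ≰⇒> λ X≤Y →
  -- k·X < X + k·X = (k+1)·X ≤ (k+1)·Y = k·X
  <-irrefl eq (<-≤-trans (m<n+m (k * X) X>0) (*-monoʳ-≤ (suc k) X≤Y))

-- With k ≥ 1:  T(2,2k;k) = τ(k+1,k),  T(2,2k;k+1) = τ(k,k+1),  and the duality
-- gives k · τ(k+1,k) = (k+1) · τ(k,k+1).
corollary13 : (k : ℕ) → T2 (2 * k) k > T2 (2 * k) (suc k)
corollary13 zero        = s≤s z≤n
corollary13 k@(suc j)   =
  subst₂ _<_ (sym above) (sym at) (smaller-by-ratio k _ _ (τ-duality (suc k) k) (τ-positive k k))
  where
  2k≡k+k : 2 * k ≡ k + k
  2k≡k+k = cong (k +_) (+-identityʳ k)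
  at : T2 (2 * k) k ≡ τ (suc k) k
  at = trans (cong (λ n → T2 n k) 2k≡k+k) (T2-diagonal k k)
  above : T2 (2 * k) (suc k) ≡ τ k (suc k)
  above = trans (cong (λ n → T2 n (suc k)) (trans 2k≡k+k (sym (+-suc j k)))) (T2-diagonal j (suc k))
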